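{- Let $m\ge1$ be odd and let $G$ be a self twin parsimonious game with $n=m+4$ players whose free type representation $(x_1,\dots,x_{h-1})$ has an odd number of components. Then its pivot $x_{h/2}$ is an even number.
   Context: Parsimonious (P) games: constant-sum homogeneous weighted majority games on $n$ players, without dummies and without dictator, having exactly $n$ minimal winning coalitions (homogeneous: weights $\mathbf w$, quota $q$, $S$ winning iff $\sum_{i\in S}w_i\ge q$, with equality for every minimal winning $S$). Each has a unique minimal homogeneous representation with integer weights $1=w_1\le\dots\le w_n$. Binary representation: $\mathbf b\in\{0,1\}^n$, $b_1=1$, $b_i=1$ iff $w_i>w_{i-1}$. Known: $b_1=1,b_2=0,b_{n-1}=0,b_n=1$ always, and $(b_3,\dots,b_{n-2})$ determines the game, every vector in $\{0,1\}^{n-4}$ arising. The number of types $h$ is the number of distinct weights; the type representation is $(x_1,\dots,x_h)$, $x_t$ the number of players with the $t$-th smallest distinct weight ($x_h=1$); the free type representation is $(x_1,\dots,x_{h-1})$. A P game is self twin if $b_i=b_{n+1-i}$ for $i=3,\dots,n-2$. When $h-1$ is odd, the middle component $x_{h/2}$ is called the pivot. -}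

module Defs where

open import Data.Nat using (ℕ; zero; suc; _+_; _∸_; _≤_)
open import Data.Nat.Divisibility using (_∣_)
open import Data.Bool using (Bool; true; false)
open import Data.Vec using (Vec; []; _∷_; toList)
open import Data.List using (List; []; _∷_; length; filter)
open import Data.Nat using (_≟_)
open import Relation.Binary.PropositionalEquality using (_≡_)
open import Relation.Nullary using (¬_)

Even : ℕ → Set
Even n = 2 ∣ n

Odd : ℕ → Set
Odd n = ¬ (2 ∣ n)

-- A P game on n players is represented by its binary representation
-- b = (b_1,…,b_n) ∈ {0,1}^n (true = 1); players are numbered 1..n.

-- b_i, 1-based (out-of-range indices give false; never used out of range)
bitAt : ∀ {n} → Vec Bool n → ℕ → Bool
bitAt [] _ = false
bitAt (x ∷ xs) zero = false
bitAt (x ∷ xs) (suc zero) = x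
bitAt (x ∷ xs) (suc (suc i)) = bitAt xs (suc i)

-- Binary representation of a parsimonious game on n players:
-- b_1 = 1, b_2 = 0, b_{n-1} = 0, b_n = 1  (b_3..b_{n-2} arbitrary; every
-- such vector is the binary representation of exactly one P game).
IsPGameBinary : ∀ {n} → Vec Bool n → Set
IsPGameBinary {n} b =
  5 ≤ n × bitAt b 1 ≡ true × bitAt b 2 ≡ false
  × bitAt b (n ∸ 1) ≡ false × bitAt b n ≡ true
  where open import Data.Product using (_×_)

-- Minimal homogeneous integer weights recovered from b:
-- w_1 = 1, w_i = w_{i-1} + b_i, i.e. w_i = b_1 + … + b_i.
weightsFrom : ∀ {n} → ℕ → Vec Bool n → Vec ℕ n
weightsFrom acc [] = []
weightsFrom acc (true ∷ bs) = suc acc ∷ weightsFrom (suc acc) bs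
weightsFrom acc (false ∷ bs) = acc ∷ weightsFrom acc bs

weights : ∀ {n} → Vec Bool n → Vec ℕ n
weights b = weightsFrom 0 b

-- Number of types h = number of distinct weights (= w_n, since the
-- distinct weights are exactly 1,…,w_n).
countTrue : ∀ {n} → Vec Bool n → ℕ
countTrue [] = 0
countTrue (true ∷ bs) = suc (countTrue bs)
countTrue (false ∷ bs) = countTrue bs

numTypes : ∀ {n} → Vec Bool n → ℕ
numTypes b = countTrue b

-- Type representation: x_t = number of players whose weight is the t-th
-- smallest distinct weight, i.e. whose weight equals t (t = 1..h).
typeCount : ∀ {n} → Vec Bool n → ℕ → ℕ
typeCount b t = length (filter (λ w → w ≟ t) (toList (weights b)))

SelfTwin : ∀ {n} → Vec Bool n → Set
SelfTwin {n} b = ∀ i → 3 ≤ i → i ≤ n ∸ 2 → bitAt b i ≡ bitAt b (suc n ∸ i)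

{-# OPTIONS --safe #-}
-- The weight of player i is the number of ones among b₁ … bᵢ, so the pivot counts the
-- prefixes of b with exactly h/2 ones.  The boundary bits b₁ = bₙ = 1, b₂ = bₙ₋₁ = 0
-- together with self-twinness make b a palindrome of odd length n.  In such a palindrome
-- with 2k ones, a prefix of length ℓ has k ones iff its complementary suffix does, i.e. iff
-- the prefix of length n − ℓ does; as ℓ ↦ n − ℓ has no fixed point on {0, …, n}, these
-- prefixes come in pairs (and for k = h/2 ≥ 1 the empty prefix is not among them).  The
-- pairing is carried out by peeling off the outer letters of the palindrome.
module Submission where

open import Defs
open import Data.Nat using (ℕ; _+_; _∸_; _/_)
open import Data.Bool using (Bool)
open import Data.Vec using (Vec)

open import Data.Bool using (true; false)
open import Data.Empty using (⊥-elim)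
open import Data.List using (List; []; _∷_; _++_; _∷ʳ_; length; filter; map; foldl; applyUpTo)
open import Data.List.Properties using (length-++; filter-++; filter-reject; foldl-∷ʳ; applyUpTo-∷ʳ)
open import Data.List.Scans.Base using (scanl)
open import Data.Nat using (zero; suc; _*_; _≡ᵇ_; _≤_; z≤n; s≤s)
open import Data.Nat.Properties
open import Data.Nat.Divisibility using (_∣0; ∣-refl; ∣m∣n⇒∣m+n; ∣m+n∣m⇒∣n)
open import Data.Nat.DivMod using (m*n/n≡m)
open import Data.Product using (∃-syntax; _,_)
open import Data.Vec using ([]; _∷_; toList)
open import Function using (_∘_)
open import Level using (Level)
open import Relation.Binary.PropositionalEquality

private
  variable
    a : Level
    A B : Set a

data OddPalindrome {A : Set a} : List A → Set a where
  [_]  : ∀ x → OddPalindrome (x ∷ [])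
  wrap : ∀ x {xs} → OddPalindrome xs → OddPalindrome (x ∷ xs ∷ʳ x)

Symmetric : ℕ → (ℕ → A) → Set _
Symmetric n g = ∀ i j → suc (i + j) ≡ n → g i ≡ g j

odd-2+n⇒odd-n : ∀ n → Odd (2 + n) → Odd n
odd-2+n⇒odd-n n odd-2+n 2∣n = odd-2+n (∣m∣n⇒∣m+n ∣-refl 2∣n)

odd-n⇒odd-2+n : ∀ n → Odd n → Odd (2 + n)
odd-n⇒odd-2+n n odd-n 2∣2+n = odd-n (∣m+n∣m⇒∣n 2∣2+n ∣-refl)

applyUpTo-oddPalindrome : ∀ n {g : ℕ → A} → Odd n → Symmetric n g → OddPalindrome (applyUpTo g n)
applyUpTo-oddPalindrome zero          odd _   = ⊥-elim (odd (2 ∣0))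
applyUpTo-oddPalindrome (suc zero)    _   _   = [ _ ]
applyUpTo-oddPalindrome (suc (suc n)) {g} odd sym-g =
  subst OddPalindrome applyUpTo-wrap
    (wrap (g 0) (applyUpTo-oddPalindrome n (odd-2+n⇒odd-n n odd) sym-inner))
  where
  sym-inner : Symmetric n (g ∘ suc)
  sym-inner i j eq = sym-g (suc i) (suc j) (cong (suc ∘ suc) (trans (+-suc i j) eq))

  applyUpTo-wrap : g 0 ∷ applyUpTo (g ∘ suc) n ∷ʳ g 0 ≡ applyUpTo g (suc (suc n))
  applyUpTo-wrap = cong (g 0 ∷_) (begin
    applyUpTo (g ∘ suc) n ∷ʳ g 0       ≡⟨ cong (applyUpTo (g ∘ suc) n ∷ʳ_) (sym-g 0 (suc n) refl) ⟩
    applyUpTo (g ∘ suc) n ∷ʳ g (suc n) ≡⟨ applyUpTo-∷ʳ (g ∘ suc) n ⟩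
    applyUpTo (g ∘ suc) (suc n)        ∎)
    where open ≡-Reasoning

scanl-∷ʳ : ∀ (f : A → B → A) e xs x → scanl f e (xs ∷ʳ x) ≡ scanl f e xs ∷ʳ f (foldl f e xs) x
scanl-∷ʳ f e []       x = refl
scanl-∷ʳ f e (y ∷ xs) x = cong (e ∷_) (scanl-∷ʳ f (f e y) xs x)

module _ {f : A → B → A} {h : A → A} (h-commutes : ∀ e x → h (f e x) ≡ f (h e) x) where

  foldl-commute : ∀ e xs → foldl f (h e) xs ≡ h (foldl f e xs)
  foldl-commute e []       = refl
  foldl-commute e (x ∷ xs) =
    trans (cong (λ e′ → foldl f e′ xs) (sym (h-commutes e x))) (foldl-commute (f e x) xs)

  scanl-commute : ∀ e xs → scanl f (h e) xs ≡ map h (scanl f e xs)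
  scanl-commute e []       = refl
  scanl-commute e (x ∷ xs) =
    cong (h e ∷_)
      (trans (cong (λ e′ → scanl f e′ xs) (sym (h-commutes e x))) (scanl-commute (f e x) xs))

addBit : ℕ → Bool → ℕ
addBit w true  = suc w
addBit w false = w

trues : List Bool → ℕ
trues = foldl addBit 0

prefixTrues : List Bool → List ℕ
prefixTrues = scanl addBit 0

suc-addBit : ∀ w x → suc (addBit w x) ≡ addBit (suc w) x
suc-addBit w true  = refl
suc-addBit w false = refl

trues-true∷ : ∀ xs → trues (true ∷ xs) ≡ suc (trues xs)
trues-true∷ = foldl-commute suc-addBit 0

prefixTrues-true∷ : ∀ xs → prefixTrues (true ∷ xs) ≡ 0 ∷ map suc (prefixTrues xs)
prefixTrues-true∷ xs = cong (0 ∷_) (scanl-commute suc-addBit 0 xs)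

trues-∷ʳ : ∀ xs x → trues (xs ∷ʳ x) ≡ addBit (trues xs) x
trues-∷ʳ xs x = foldl-∷ʳ addBit 0 x xs

prefixTrues-∷ʳ : ∀ xs x → prefixTrues (xs ∷ʳ x) ≡ prefixTrues xs ∷ʳ addBit (trues xs) x
prefixTrues-∷ʳ = scanl-∷ʳ addBit 0

multiplicity : ℕ → List ℕ → ℕ
multiplicity k xs = length (filter (_≟ k) xs)

multiplicity-++ : ∀ k xs ys → multiplicity k (xs ++ ys) ≡ multiplicity k xs + multiplicity k ys
multiplicity-++ k xs ys = trans (cong length (filter-++ (_≟ k) xs ys)) (length-++ (filter (_≟ k) xs))

multiplicity-∷ʳ : ∀ k xs x → multiplicity k (xs ∷ʳ x) ≡ multiplicity k (x ∷ xs)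
multiplicity-∷ʳ k xs x = begin
  multiplicity k (xs ∷ʳ x)                          ≡⟨ multiplicity-++ k xs (x ∷ []) ⟩
  multiplicity k xs + multiplicity k (x ∷ [])       ≡⟨ +-comm (multiplicity k xs) _ ⟩
  multiplicity k (x ∷ []) + multiplicity k xs       ≡⟨ multiplicity-++ k (x ∷ []) xs ⟨
  multiplicity k (x ∷ xs)                           ∎
  where open ≡-Reasoning

multiplicity-∷-≢ : ∀ {k x} xs → x ≢ k → multiplicity k (x ∷ xs) ≡ multiplicity k xs
multiplicity-∷-≢ {k} xs x≢k = cong length (filter-reject (_≟ k) x≢k)

-- Both `x ≟ k` and `suc x ≟ suc k` decide by the test `x ≡ᵇ k`.
multiplicity-map-suc : ∀ k xs → multiplicity (suc k) (map suc xs) ≡ multiplicity k xs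
multiplicity-map-suc k []       = refl
multiplicity-map-suc k (x ∷ xs) with x ≡ᵇ k
... | true  = cong suc (multiplicity-map-suc k xs)
... | false = multiplicity-map-suc k xs

oddPalindrome-halfPrefixes-even : ∀ {xs} → OddPalindrome xs → ∀ k → trues xs ≡ k + k
                                  → Even (multiplicity k (prefixTrues xs))
oddPalindrome-halfPrefixes-even [ false ] zero    refl = ∣-refl
oddPalindrome-halfPrefixes-even [ true ]  (suc k) eq   = ⊥-elim (m+1+n≢0 k (sym (suc-injective eq)))
oddPalindrome-halfPrefixes-even (wrap false {xs} p) k eq =
  subst Even (sym count-ends) (ends-even k (trans (sym (trues-∷ʳ xs false)) eq))
  where
  count-ends : multiplicity k (prefixTrues (false ∷ xs ∷ʳ false))
             ≡ multiplicity k (0 ∷ []) + multiplicity k (trues xs ∷ prefixTrues xs)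
  count-ends = begin
    multiplicity k (0 ∷ prefixTrues (xs ∷ʳ false))
      ≡⟨ multiplicity-++ k (0 ∷ []) _ ⟩
    multiplicity k (0 ∷ []) + multiplicity k (prefixTrues (xs ∷ʳ false))
      ≡⟨ cong (λ ys → multiplicity k (0 ∷ []) + multiplicity k ys) (prefixTrues-∷ʳ xs false) ⟩
    multiplicity k (0 ∷ []) + multiplicity k (prefixTrues xs ∷ʳ trues xs)
      ≡⟨ cong (multiplicity k (0 ∷ []) +_) (multiplicity-∷ʳ k (prefixTrues xs) (trues xs)) ⟩
    multiplicity k (0 ∷ []) + multiplicity k (trues xs ∷ prefixTrues xs)
      ∎
    where open ≡-Reasoning

  -- The two outer prefixes have 0 and 2k ones, so either both or neither are counted.
  ends-even : ∀ k → trues xs ≡ k + k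
            → Even (multiplicity k (0 ∷ []) + multiplicity k (trues xs ∷ prefixTrues xs))
  ends-even zero    eq′ rewrite eq′ = ∣m∣n⇒∣m+n ∣-refl (oddPalindrome-halfPrefixes-even p zero eq′)
  ends-even (suc k) eq′ rewrite eq′ =
    subst Even (sym (multiplicity-∷-≢ (prefixTrues xs) (m+1+n≢m (suc k))))
      (oddPalindrome-halfPrefixes-even p (suc k) eq′)
oddPalindrome-halfPrefixes-even (wrap true {xs} p) k eq = inner-even k (trans (sym trues-wrap) eq)
  where
  trues-wrap : trues (true ∷ xs ∷ʳ true) ≡ suc (suc (trues xs))
  trues-wrap = trans (trues-true∷ (xs ∷ʳ true)) (cong suc (trues-∷ʳ xs true))

  inner-even : ∀ k → suc (suc (trues xs)) ≡ k + k
             → Even (multiplicity k (prefixTrues (true ∷ xs ∷ʳ true)))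
  inner-even zero    ()
  inner-even (suc k) eq′ =
    subst Even (sym count-shift) (oddPalindrome-halfPrefixes-even p k trues-xs)
    where
    trues-xs : trues xs ≡ k + k
    trues-xs = suc-injective (trans (suc-injective eq′) (+-suc k k))

    1+trues-xs≢k : suc (trues xs) ≢ k
    1+trues-xs≢k eq″ = m≢1+m+n k (sym (trans (cong suc (sym trues-xs)) eq″))

    count-shift : multiplicity (suc k) (prefixTrues (true ∷ xs ∷ʳ true))
                ≡ multiplicity k (prefixTrues xs)
    count-shift = begin
      multiplicity (suc k) (prefixTrues (true ∷ xs ∷ʳ true))
        ≡⟨ cong (multiplicity (suc k)) (prefixTrues-true∷ (xs ∷ʳ true)) ⟩
      multiplicity (suc k) (map suc (prefixTrues (xs ∷ʳ true)))
        ≡⟨ multiplicity-map-suc k (prefixTrues (xs ∷ʳ true)) ⟩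
      multiplicity k (prefixTrues (xs ∷ʳ true))
        ≡⟨ cong (multiplicity k) (prefixTrues-∷ʳ xs true) ⟩
      multiplicity k (prefixTrues xs ∷ʳ suc (trues xs))
        ≡⟨ multiplicity-∷ʳ k (prefixTrues xs) _ ⟩
      multiplicity k (suc (trues xs) ∷ prefixTrues xs)
        ≡⟨ multiplicity-∷-≢ (prefixTrues xs) 1+trues-xs≢k ⟩
      multiplicity k (prefixTrues xs)
        ∎
      where open ≡-Reasoning

toList-bitAt : ∀ {n} (v : Vec Bool n) → toList v ≡ applyUpTo (λ i → bitAt v (suc i)) n
toList-bitAt []       = refl
toList-bitAt (x ∷ v) = cong (x ∷_) (toList-bitAt v)

scanl-weightsFrom : ∀ {n} w (v : Vec Bool n)
                    → scanl addBit w (toList v) ≡ w ∷ toList (weightsFrom w v)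
scanl-weightsFrom w []          = refl
scanl-weightsFrom w (true ∷ v)  = cong (w ∷_) (scanl-weightsFrom (suc w) v)
scanl-weightsFrom w (false ∷ v) = cong (w ∷_) (scanl-weightsFrom w v)

trues-countTrue : ∀ {n} (v : Vec Bool n) → trues (toList v) ≡ countTrue v
trues-countTrue []          = refl
trues-countTrue (true ∷ v)  = trans (trues-true∷ (toList v)) (cong suc (trues-countTrue v))
trues-countTrue (false ∷ v) = trues-countTrue v

pGame-edge-symmetric : ∀ {n} (b : Vec Bool n) → IsPGameBinary b
                       → ∀ i j → i ≤ 1 → suc (i + j) ≡ n → bitAt b (suc i) ≡ bitAt b (suc j)
pGame-edge-symmetric _ (_ , b₁ , _ , _ , bₙ)   0 j _ refl = trans b₁ (sym bₙ)
pGame-edge-symmetric _ (_ , _ , b₂ , bₙ₋₁ , _) 1 j _ refl = trans b₂ (sym bₙ₋₁)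
pGame-edge-symmetric _ _ (suc (suc _)) _ (s≤s ()) _

pGame-symmetric : ∀ {n} (b : Vec Bool n) → IsPGameBinary b → SelfTwin b
                  → Symmetric n (λ i → bitAt b (suc i))
pGame-symmetric b pgame _ 0 j eq = pGame-edge-symmetric b pgame 0 j z≤n eq
pGame-symmetric b pgame _ 1 j eq = pGame-edge-symmetric b pgame 1 j (s≤s z≤n) eq
pGame-symmetric b pgame _ i@(suc (suc _)) 0 eq =
  sym (pGame-edge-symmetric b pgame 0 i z≤n (trans (cong suc (+-comm 0 i)) eq))
pGame-symmetric b pgame _ i@(suc (suc _)) 1 eq =
  sym (pGame-edge-symmetric b pgame 1 i (s≤s z≤n) (trans (cong suc (+-comm 1 i)) eq))
pGame-symmetric b _ twin (suc (suc i)) (suc (suc j)) refl =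
  trans (twin (3 + i) (s≤s (s≤s (s≤s z≤n))) bound) (cong (bitAt b) mirror-index)
  where
  bound : 3 + i ≤ suc (i + (2 + j))
  bound = s≤s (≤-trans (≤-reflexive (+-comm 2 i)) (+-monoʳ-≤ i (s≤s (s≤s z≤n))))

  mirror-index : suc (i + (2 + j)) ∸ i ≡ 3 + j
  mirror-index = trans (cong (_∸ i) (sym (+-suc i (2 + j)))) (m+n∸m≡n i (3 + j))

selfTwin-typeCount-even : ∀ {n} (b : Vec Bool n) → Odd n → IsPGameBinary b → SelfTwin b
                          → ∀ k → numTypes b ≡ suc k + suc k → Even (typeCount b (suc k))
selfTwin-typeCount-even {n} b odd-n pgame twin k h≡ =
  subst Even (cong (multiplicity (suc k)) (scanl-weightsFrom 0 b))
    (oddPalindrome-halfPrefixes-even palindrome (suc k) (trans (trues-countTrue b) h≡))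
  where
  palindrome : OddPalindrome (toList b)
  palindrome = subst OddPalindrome (sym (toList-bitAt b))
    (applyUpTo-oddPalindrome n odd-n (pGame-symmetric b pgame twin))

odd-pred⇒double : ∀ h → Odd (h ∸ 1) → ∃[ k ] h ≡ suc k + suc k
odd-pred⇒double 0 odd = ⊥-elim (odd (2 ∣0))
odd-pred⇒double 1 odd = ⊥-elim (odd (2 ∣0))
odd-pred⇒double 2 _   = 0 , refl
odd-pred⇒double (suc (suc (suc h))) odd =
  let k , h≡ = odd-pred⇒double (suc h) (odd-2+n⇒odd-n h odd)
  in suc k , cong (suc ∘ suc) (trans h≡ (sym (+-suc k (suc k))))

[n+n]/2≡n : ∀ n → (n + n) / 2 ≡ n
[n+n]/2≡n n = trans (cong (_/ 2) n+n≡n*2) (m*n/n≡m n 2)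
  where
  n+n≡n*2 : n + n ≡ n * 2
  n+n≡n*2 = trans (cong (n +_) (sym (+-identityʳ n))) (*-comm 2 n)

proposition6p5 : (m : ℕ) → Odd m → (b : Vec Bool (m + 4)) → IsPGameBinary b → SelfTwin b
                   → Odd (numTypes b ∸ 1) → Even (typeCount b (numTypes b / 2))
proposition6p5 m odd-m b pgame twin odd-h∸1 =
  let k , h≡ = odd-pred⇒double (numTypes b) odd-h∸1
  in subst (Even ∘ typeCount b) (sym (trans (cong (_/ 2) h≡) ([n+n]/2≡n (suc k))))
       (selfTwin-typeCount-even b odd-n pgame twin k h≡)
  where
  odd-n : Odd (m + 4)
  odd-n = subst Odd (+-comm 4 m) (odd-n⇒odd-2+n (2 + m) (odd-n⇒odd-2+n m odd-m))
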